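{- Let $G$ be a two-directional orthogonal ray graph with a given bipartition $(U,V)$ and without twins. Then $G$ has exactly one normalized representation if and only if $G$ is a chain graph.
   Context: All graphs are finite and simple. A bipartite graph $G$ with a given bipartition $(U,V)$ is a two-directional orthogonal ray graph if there is a pair of linear orders $(<_x,<_y)$ on $V(G)$ such that for all $u\in U$, $v\in V$: $uv\in E(G)$ iff $u<_x v$ and $u<_y v$; such a pair is called a representation of $G$. Two vertices are twins if they have the same (open) neighborhood; throughout, graphs are assumed to have no twins. A representation $(<_x,<_y)$ is normalized if: (a) for all $u_1,u_2\in U$: ($u_1<_x u_2$ and $u_1<_y u_2$) iff $N(u_1)\supsetneq N(u_2)$; (b) for all $v_1,v_2\in V$: ($v_1<_x v_2$ and $v_1<_y v_2$) iff $N(v_1)\subsetneq N(v_2)$; (c) for all $u\in U$, $v\in V$: ($v<_x u$ and $v<_y u$) iff $N(v)\subsetneq N(v')$ for every $v'\in N(u)$. A bipartite graph with bipartition $(U,V)$ is a chain graph if there is a linear order $<_U$ on $U$ with $u_1<_U u_2 \iff N(u_1)\subseteq N(u_2)$ for all $u_1,u_2\in U$ (equivalently, it contains no two independent edges, where edges $u_1v_1,u_2v_2$ are independent if they are disjoint and neither $u_1v_2$ nor $u_2v_1$ is an edge). -}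

module Defs where

open import Data.Nat using (ℕ)
open import Data.Fin using (Fin)
open import Data.Bool using (Bool; true)
open import Data.Sum using (_⊎_; inj₁; inj₂)
open import Data.Product using (_×_; Σ; _,_)
open import Data.Empty using (⊥)
open import Relation.Nullary using (¬_)
open import Relation.Binary.Core using (Rel)
open import Relation.Binary.Structures using (IsStrictTotalOrder; IsTotalOrder)
open import Relation.Binary.PropositionalEquality using (_≡_; _≢_)
open import Function.Bundles using (_⇔_)
open import Level using (0ℓ)

-- A finite bipartite graph with a given bipartition (U,V):
-- U = Fin m, V = Fin n, edges given by a Boolean adjacency matrix.
record BipGraph : Set where
  field
    m n : ℕ
    adj : Fin m → Fin n → Bool

module _ (G : BipGraph) where
  open BipGraph G

  U V : Set
  U = Fin m
  V = Fin n

  Vtx : Set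
  Vtx = U ⊎ V

  E : U → V → Set
  E u v = adj u v ≡ true

  Adj : Vtx → Vtx → Set
  Adj (inj₁ u) (inj₁ u') = ⊥
  Adj (inj₁ u) (inj₂ v)  = E u v
  Adj (inj₂ v) (inj₁ u)  = E u v
  Adj (inj₂ v) (inj₂ v') = ⊥

  Twins : Vtx → Vtx → Set
  Twins w w' = (w ≢ w') × (∀ x → Adj w x ⇔ Adj w' x)

  NoTwins : Set
  NoTwins = ∀ w w' → ¬ Twins w w'

  _⊆U_ : U → U → Set
  u ⊆U u' = ∀ v → E u v → E u' v

  _⊊U_ : U → U → Set
  u ⊊U u' = (u ⊆U u') × ¬ (u' ⊆U u)

  _⊆V_ : V → V → Set
  v ⊆V v' = ∀ u → E u v → E u v'

  _⊊V_ : V → V → Set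
  v ⊊V v' = (v ⊆V v') × ¬ (v' ⊆V v)

  LinOrd : Set₁
  LinOrd = Σ (Rel Vtx 0ℓ) (λ R → IsStrictTotalOrder _≡_ R)

  IsRepresentation : LinOrd → LinOrd → Set
  IsRepresentation (_<x_ , _) (_<y_ , _) =
    ∀ u v → E u v ⇔ ((inj₁ u <x inj₂ v) × (inj₁ u <y inj₂ v))

  IsNormalized : LinOrd → LinOrd → Set
  IsNormalized (_<x_ , _) (_<y_ , _) =
    (∀ u₁ u₂ → ((inj₁ u₁ <x inj₁ u₂) × (inj₁ u₁ <y inj₁ u₂)) ⇔ (u₂ ⊊U u₁))
    × (∀ v₁ v₂ → ((inj₂ v₁ <x inj₂ v₂) × (inj₂ v₁ <y inj₂ v₂)) ⇔ (v₁ ⊊V v₂))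
    × (∀ u v → ((inj₂ v <x inj₁ u) × (inj₂ v <y inj₁ u))
                ⇔ (∀ v' → E u v' → v ⊊V v'))

  NormalizedRep : LinOrd → LinOrd → Set
  NormalizedRep X Y = IsRepresentation X Y × IsNormalized X Y

  IsTDORG : Set₁
  IsTDORG = Σ LinOrd (λ X → Σ LinOrd (λ Y → IsRepresentation X Y))

  SameOrd : LinOrd → LinOrd → Set
  SameOrd (R , _) (S , _) = ∀ a b → R a b ⇔ S a b

  UniqueNormalizedRep : Set₁
  UniqueNormalizedRep =
    Σ LinOrd (λ X → Σ LinOrd (λ Y → NormalizedRep X Y ×
      (∀ X' Y' → NormalizedRep X' Y' → SameOrd X X' × SameOrd Y Y')))

  IsChainGraph : Set₁
  IsChainGraph = Σ (Rel U 0ℓ) (λ _≤U_ → IsTotalOrder _≡_ _≤U_ ×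
                   (∀ u₁ u₂ → (u₁ ≤U u₂) ⇔ (u₁ ⊆U u₂)))

{-# OPTIONS --safe #-}
module Submission where

-- Swapping the two orders of a normalized representation gives again a
-- normalized representation, so if it is unique then <x and <y coincide; but a
-- representation by a single order forces N(u₂) ⊆ N(u₁) whenever u₁ <x u₂, so
-- the neighbourhoods in U are nested and G is a chain graph.
--
-- Conversely, in a chain graph without twins let rank u be the number of u'
-- with N(u) ⊊ N(u'), and deg v the degree of v. Both are injective, uv is an
-- edge iff rank u < deg v, and (c) holds for v, u iff deg v ≤ rank u. So the
-- linear order ≺ listing U by increasing rank, V by increasing degree, with
-- u ≺ v iff rank u < deg v, makes (≺, ≺) a normalized representation. Each
-- relation a ≺ b is forced, by (a)–(c) or by the representation condition, in
-- both orders of any normalized representation; as ≺ is total, that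
-- representation is (≺, ≺).

open import Defs
open import Data.Bool using (true) renaming (_≟_ to _≟ᵇ_)
open import Data.Empty using (⊥-elim)
open import Data.Fin using (Fin)
open import Data.Fin.Properties using (all?; ¬∀⟶∃¬) renaming (_≟_ to _≟ᶠ_)
open import Data.Fin.Subset using (Subset; ∣_∣) renaming (_∈_ to _∈ₛ_)
open import Data.Fin.Subset.Properties using (p⊆q⇒∣p∣≤∣q∣; p⊂q⇒∣p∣<∣q∣)
open import Data.Nat using (ℕ; _<_; _≤_)
open import Data.Nat.Properties
  using (<-cmp; <-irrefl; <-asym; <-trans; <-≤-trans; ≤-<-trans; <⇒≤; <⇒≱; ≤-reflexive)
open import Data.Product using (_×_; _,_; proj₁; proj₂; swap; ∃)
import Data.Sum as Sum
open import Data.Sum using (inj₁; inj₂)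
open import Data.Sum.Properties using (inj₁-injective; inj₂-injective)
open import Data.Vec using (tabulate)
open import Data.Vec.Properties using (lookup∘tabulate; []=⇒lookup; lookup⇒[]=)
open import Function using (_∘_; flip; id)
open import Function.Bundles using (_⇔_; mk⇔; Equivalence)
open import Level using (0ℓ)
open import Relation.Binary.Core using (Rel; _⇒_; _Preserves_⟶_)
open import Relation.Binary.Consequences using (tri⇒irr)
open import Relation.Binary.Definitions
  using (Total; Trichotomous; tri<; tri≈; tri>; Asymmetric; Antisymmetric)
  renaming (Decidable to Decidable₂)
open import Relation.Binary.PropositionalEquality
  using (_≡_; refl; sym; trans; cong; isEquivalence; resp₂)
open import Relation.Binary.Structures using (IsStrictTotalOrder; IsTotalOrder)
open import Relation.Nullary using (¬_; Dec; yes; no; does; contradiction)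
open import Relation.Nullary.Decidable using (_→-dec_; _×-dec_; ¬?; dec-true; decidable-stable)
open import Relation.Unary using (Pred; Decidable; _⊆_)

open Equivalence using (to; from)

×-swapʳ : ∀ {A B C : Set} → A ⇔ (B × C) → A ⇔ (C × B)
×-swapʳ e = mk⇔ (swap ∘ to e) (from e ∘ swap)

×-swapˡ : ∀ {A B C : Set} → (B × C) ⇔ A → (C × B) ⇔ A
×-swapˡ e = mk⇔ (to e ∘ swap) (swap ∘ from e)

×-diagʳ : ∀ {A B : Set} → A ⇔ B → A ⇔ (B × B)
×-diagʳ e = mk⇔ (λ a → to e a , to e a) (from e ∘ proj₁)

×-diagˡ : ∀ {A B : Set} → A ⇔ B → (A × A) ⇔ B
×-diagˡ e = mk⇔ (to e ∘ proj₁) (λ b → from e b , from e b)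

module _ {k} {P : Pred (Fin k) 0ℓ} (P? : Decidable P) where

  subsetOf : Subset k
  subsetOf = tabulate (does ∘ P?)

  ∈-subsetOf⁺ : ∀ {x} → P x → x ∈ₛ subsetOf
  ∈-subsetOf⁺ {x} p = lookup⇒[]= x subsetOf (trans (lookup∘tabulate _ x) (dec-true (P? x) p))

  ∈-subsetOf⁻ : ∀ {x} → x ∈ₛ subsetOf → P x
  ∈-subsetOf⁻ {x} x∈ with P? x | trans (sym (lookup∘tabulate (does ∘ P?) x)) ([]=⇒lookup x∈)
  ... | yes p | _ = p

count : ∀ {k} {P : Pred (Fin k) 0ℓ} → Decidable P → ℕ
count P? = ∣ subsetOf P? ∣

module _ {k} {P Q : Pred (Fin k) 0ℓ} (P? : Decidable P) (Q? : Decidable Q) where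

  count-mono : P ⊆ Q → count P? ≤ count Q?
  count-mono P⊆Q = p⊆q⇒∣p∣≤∣q∣ (∈-subsetOf⁺ Q? ∘ P⊆Q ∘ ∈-subsetOf⁻ P?)

  count-mono-strict : P ⊆ Q → ∀ {x} → Q x → ¬ P x → count P? < count Q?
  count-mono-strict P⊆Q {x} Qx ¬Px = p⊂q⇒∣p∣<∣q∣
    ( ∈-subsetOf⁺ Q? ∘ P⊆Q ∘ ∈-subsetOf⁻ P?
    , x , ∈-subsetOf⁺ Q? Qx , ¬Px ∘ ∈-subsetOf⁻ P? )

tri∧⊆asym⇒⊇ : ∀ {A : Set} {_<_ _<′_ : Rel A 0ℓ} →
  Trichotomous _≡_ _<_ → Asymmetric _<′_ → _<_ ⇒ _<′_ → _<′_ ⇒ _<_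
tri∧⊆asym⇒⊇ compare asym <⇒<′ {a} {b} a<′b with compare a b
... | tri< a<b _ _ = a<b
... | tri≈ _ refl _ = contradiction a<′b (asym a<′b)
... | tri> _ _ b<a = contradiction (<⇒<′ b<a) (asym a<′b)

module StrictlyMonotone {A : Set} {_≼_ : Rel A 0ℓ}
  (≼-total : Total _≼_) (_≼?_ : Decidable₂ _≼_) (≼-antisym : Antisymmetric _≡_ _≼_)
  {f : A → ℕ} (f-mono : f Preserves _≼_ ⟶ _≤_)
  (f-strict : ∀ {a b} → a ≼ b × ¬ b ≼ a → f a < f b) where

  reflects-≤ : ∀ {a b} → f a ≤ f b → a ≼ b
  reflects-≤ {a} {b} fa≤fb = decidable-stable (a ≼? b) λ a⋠b →
    let b≼a = Sum.fromInj₂ (λ a≼b → contradiction a≼b a⋠b) (≼-total a b)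
    in <⇒≱ (f-strict (b≼a , a⋠b)) fa≤fb

  reflects-< : ∀ {a b} → f a < f b → a ≼ b × ¬ b ≼ a
  reflects-< fa<fb = reflects-≤ (<⇒≤ fa<fb) , λ b≼a → <⇒≱ fa<fb (f-mono b≼a)

  injective : ∀ {a b} → f a ≡ f b → a ≡ b
  injective fa≡fb = ≼-antisym (reflects-≤ (≤-reflexive fa≡fb)) (reflects-≤ (≤-reflexive (sym fa≡fb)))

module _ (G : BipGraph) where
  open BipGraph G using (m; adj)

  infix 4 _⊆ᵁ_ _⊊ᵁ_ _⊆ⱽ_ _⊊ⱽ_

  _⊆ᵁ_ _⊊ᵁ_ : Rel (U G) 0ℓ
  _⊆ᵁ_ = _⊆U_ G
  _⊊ᵁ_ = _⊊U_ G

  _⊆ⱽ_ _⊊ⱽ_ : Rel (V G) 0ℓ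
  _⊆ⱽ_ = _⊆V_ G
  _⊊ⱽ_ = _⊊V_ G

  ⊊ᵁ-irrefl : ∀ {u} → ¬ u ⊊ᵁ u
  ⊊ᵁ-irrefl (u⊆u , u⊈u) = u⊈u u⊆u

  ⊊ⱽ-irrefl : ∀ {v} → ¬ v ⊊ⱽ v
  ⊊ⱽ-irrefl (v⊆v , v⊈v) = v⊈v v⊆v

  ⊆ᵁ-antisym : NoTwins G → Antisymmetric _≡_ _⊆ᵁ_
  ⊆ᵁ-antisym noTwins {u₁} {u₂} s t = decidable-stable (u₁ ≟ᶠ u₂) λ u₁≢u₂ →
    noTwins (inj₁ u₁) (inj₁ u₂) (u₁≢u₂ ∘ inj₁-injective , λ
      { (inj₁ _) → mk⇔ id id ; (inj₂ v) → mk⇔ (s v) (t v) })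

  ⊆ⱽ-antisym : NoTwins G → Antisymmetric _≡_ _⊆ⱽ_
  ⊆ⱽ-antisym noTwins {v₁} {v₂} s t = decidable-stable (v₁ ≟ᶠ v₂) λ v₁≢v₂ →
    noTwins (inj₂ v₁) (inj₂ v₂) (v₁≢v₂ ∘ inj₂-injective , λ
      { (inj₁ u) → mk⇔ (s u) (t u) ; (inj₂ _) → mk⇔ id id })

  ⊆ᵁ-isTotalOrder : NoTwins G → Total _⊆ᵁ_ → IsTotalOrder _≡_ _⊆ᵁ_
  ⊆ᵁ-isTotalOrder noTwins total = record
    { isPartialOrder = record
      { isPreorder = record
        { isEquivalence = isEquivalence
        ; reflexive = λ { refl _ e → e }
        ; trans = λ s t v → t v ∘ s v }
      ; antisym = ⊆ᵁ-antisym noTwins }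
    ; total = total }

  ⊆ᵁ-total⇒chainGraph : NoTwins G → Total _⊆ᵁ_ → IsChainGraph G
  ⊆ᵁ-total⇒chainGraph noTwins total = _⊆ᵁ_ , ⊆ᵁ-isTotalOrder noTwins total , λ _ _ → mk⇔ id id

  chainGraph⇒⊆ᵁ-total : IsChainGraph G → Total _⊆ᵁ_
  chainGraph⇒⊆ᵁ-total (_ , isTotalOrder , ≤⇔⊆) u₁ u₂ =
    Sum.map (to (≤⇔⊆ u₁ u₂)) (to (≤⇔⊆ u₂ u₁)) (IsTotalOrder.total isTotalOrder u₁ u₂)

  normalizedRep-swap : ∀ {X Y} → NormalizedRep G X Y → NormalizedRep G Y X
  normalizedRep-swap {_ , _} {_ , _} (rep , normU , normV , normUV) =
      (λ u v → ×-swapʳ (rep u v))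
    , (λ u₁ u₂ → ×-swapˡ (normU u₁ u₂))
    , (λ v₁ v₂ → ×-swapˡ (normV v₁ v₂))
    , (λ u v → ×-swapˡ (normUV u v))

  representation-by-one-order⇒⊇ : ∀ {X Y} → IsRepresentation G X Y → SameOrd G X Y →
    ∀ {u u'} → proj₁ X (inj₁ u) (inj₁ u') → u' ⊆ᵁ u
  representation-by-one-order⇒⊇ {_ , isSTO} {_ , _} rep x⇔y {u} {u'} u<u' v e =
    from (rep u v) (u<v , to (x⇔y _ _) u<v)
    where
    u<v = IsStrictTotalOrder.trans isSTO u<u' (proj₁ (to (rep u' v) e))

  representation-by-one-order⇒⊆ᵁ-total : ∀ {X Y} → IsRepresentation G X Y → SameOrd G X Y →
    Total _⊆ᵁ_
  representation-by-one-order⇒⊆ᵁ-total {X@(_ , isSTO)} {Y} rep x⇔y u₁ u₂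
    with IsStrictTotalOrder.compare isSTO (inj₁ u₁) (inj₁ u₂)
  ... | tri< u₁<u₂ _ _ = inj₂ (representation-by-one-order⇒⊇ {X} {Y} rep x⇔y u₁<u₂)
  ... | tri≈ _ refl _ = inj₁ λ _ e → e
  ... | tri> _ _ u₂<u₁ = inj₁ (representation-by-one-order⇒⊇ {X} {Y} rep x⇔y u₂<u₁)

  uniqueNormalizedRep⇒⊆ᵁ-total : UniqueNormalizedRep G → Total _⊆ᵁ_
  uniqueNormalizedRep⇒⊆ᵁ-total (X@(_ , _) , Y@(_ , _) , normalizedRep@(rep , _) , unique) =
    representation-by-one-order⇒⊆ᵁ-total {X} {Y} rep
      (proj₁ (unique Y X (normalizedRep-swap {X} {Y} normalizedRep)))

  module ChainGraph (noTwins : NoTwins G) (⊆ᵁ-total : Total _⊆ᵁ_) where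

    E? : ∀ u v → Dec (E G u v)
    E? u v = adj u v ≟ᵇ true

    _⊆ᵁ?_ : Decidable₂ _⊆ᵁ_
    u ⊆ᵁ? u' = all? λ v → E? u v →-dec E? u' v

    _⊊ᵁ?_ : Decidable₂ _⊊ᵁ_
    u ⊊ᵁ? u' = (u ⊆ᵁ? u') ×-dec ¬? (u' ⊆ᵁ? u)

    _⊆ⱽ?_ : Decidable₂ _⊆ⱽ_
    v ⊆ⱽ? v' = all? λ u → E? u v →-dec E? u v'

    ⊈ⱽ⇒∃ : ∀ {v v'} → ¬ v ⊆ⱽ v' → ∃ λ u → E G u v × ¬ E G u v'
    ⊈ⱽ⇒∃ {v} {v'} v⊈v' with ¬∀⟶∃¬ m _ (λ u → E? u v →-dec E? u v') v⊈v'
    ... | u , uv⇏uv' =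
      u , decidable-stable (E? u v) (λ ¬uv → uv⇏uv' (⊥-elim ∘ ¬uv)) , λ uv' → uv⇏uv' λ _ → uv'

    -- If u witnesses N(v) ⊈ N(v'), nestedness gives N(u) ⊆ N(u') for every neighbour u' of v'.
    ⊆ⱽ-total : Total _⊆ⱽ_
    ⊆ⱽ-total v v' with v ⊆ⱽ? v'
    ... | yes v⊆v' = inj₁ v⊆v'
    ... | no v⊈v' with ⊈ⱽ⇒∃ v⊈v'
    ...   | u , uv , ¬uv' = inj₂ λ u' u'v' →
      Sum.[ (λ u⊆u' → u⊆u' v uv) , (λ u'⊆u → contradiction (u'⊆u v' u'v') ¬uv') ] (⊆ᵁ-total u u')

    ⊆ᵁ-⊊ᵁ-trans : ∀ {u₁ u₂ u₃} → u₁ ⊆ᵁ u₂ → u₂ ⊊ᵁ u₃ → u₁ ⊊ᵁ u₃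
    ⊆ᵁ-⊊ᵁ-trans u₁⊆u₂ (u₂⊆u₃ , u₃⊈u₂) =
      (λ v → u₂⊆u₃ v ∘ u₁⊆u₂ v) , λ u₃⊆u₁ → u₃⊈u₂ (λ v → u₁⊆u₂ v ∘ u₃⊆u₁ v)

    rank : U G → ℕ
    rank u = count (u ⊊ᵁ?_)

    deg : V G → ℕ
    deg v = count (λ u → E? u v)

    rank-antitone : ∀ {u₁ u₂} → u₁ ⊆ᵁ u₂ → rank u₂ ≤ rank u₁
    rank-antitone u₁⊆u₂ = count-mono (_ ⊊ᵁ?_) (_ ⊊ᵁ?_) (⊆ᵁ-⊊ᵁ-trans u₁⊆u₂)

    rank-antitone-strict : ∀ {u₁ u₂} → u₁ ⊊ᵁ u₂ → rank u₂ < rank u₁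
    rank-antitone-strict u₁⊊u₂@(u₁⊆u₂ , _) =
      count-mono-strict (_ ⊊ᵁ?_) (_ ⊊ᵁ?_) (⊆ᵁ-⊊ᵁ-trans u₁⊆u₂) u₁⊊u₂ ⊊ᵁ-irrefl

    deg-mono : ∀ {v₁ v₂} → v₁ ⊆ⱽ v₂ → deg v₁ ≤ deg v₂
    deg-mono v₁⊆v₂ = count-mono (λ u → E? u _) (λ u → E? u _) (v₁⊆v₂ _)

    deg-mono-strict : ∀ {v₁ v₂} → v₁ ⊊ⱽ v₂ → deg v₁ < deg v₂
    deg-mono-strict (v₁⊆v₂ , v₂⊈v₁) with ⊈ⱽ⇒∃ v₂⊈v₁
    ... | u , uv₂ , ¬uv₁ = count-mono-strict (λ u → E? u _) (λ u → E? u _) (v₁⊆v₂ _) uv₂ ¬uv₁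

    open StrictlyMonotone {_≼_ = flip _⊆ᵁ_} (flip ⊆ᵁ-total) (flip _⊆ᵁ?_)
      (flip (⊆ᵁ-antisym noTwins)) rank-antitone rank-antitone-strict
      using () renaming (reflects-< to rank<⇒⊋; injective to rank-injective)

    open StrictlyMonotone ⊆ⱽ-total _⊆ⱽ?_ (⊆ⱽ-antisym noTwins) deg-mono deg-mono-strict
      using () renaming (reflects-< to deg<⇒⊊; injective to deg-injective)

    E⇒rank<deg : ∀ {u v} → E G u v → rank u < deg v
    E⇒rank<deg {u} uv =
      count-mono-strict (u ⊊ᵁ?_) (λ u' → E? u' _) (λ (u⊆u' , _) → u⊆u' _ uv) uv ⊊ᵁ-irrefl

    -- By nestedness, every neighbour u' of v satisfies N(u) ⊊ N(u').
    ¬E⇒deg≤rank : ∀ {u v} → ¬ E G u v → deg v ≤ rank u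
    ¬E⇒deg≤rank {u} {v} ¬uv = count-mono (λ u' → E? u' v) (u ⊊ᵁ?_) λ {u'} u'v →
      let u'⊈u = λ u'⊆u → ¬uv (u'⊆u v u'v)
      in Sum.fromInj₁ (λ u'⊆u → contradiction u'⊆u u'⊈u) (⊆ᵁ-total u u') , u'⊈u

    rank<deg⇒E : ∀ {u v} → rank u < deg v → E G u v
    rank<deg⇒E {u} {v} rank<deg = decidable-stable (E? u v) (<⇒≱ rank<deg ∘ ¬E⇒deg≤rank)

    deg≤rank⇒⊊N : ∀ {u v} → deg v ≤ rank u → ∀ v' → E G u v' → v ⊊ⱽ v'
    deg≤rank⇒⊊N deg≤rank v' uv' = deg<⇒⊊ (≤-<-trans deg≤rank (E⇒rank<deg uv'))

    ⊊N⇒deg≤rank : ∀ {u v} → (∀ v' → E G u v' → v ⊊ⱽ v') → deg v ≤ rank u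
    ⊊N⇒deg≤rank {v = v} v⊊N = ¬E⇒deg≤rank (⊊ⱽ-irrefl ∘ v⊊N v)

    infix 4 _≺_
    _≺_ : Rel (Vtx G) 0ℓ
    inj₁ u ≺ inj₁ u' = rank u < rank u'
    inj₁ u ≺ inj₂ v  = rank u < deg v
    inj₂ v ≺ inj₁ u  = deg v ≤ rank u
    inj₂ v ≺ inj₂ v' = deg v < deg v'

    ≺-trans : ∀ {a b c} → a ≺ b → b ≺ c → a ≺ c
    ≺-trans {inj₁ _} {inj₁ _} {inj₁ _} = <-trans
    ≺-trans {inj₁ _} {inj₁ _} {inj₂ _} = <-trans
    ≺-trans {inj₁ _} {inj₂ _} {inj₁ _} = <-≤-trans
    ≺-trans {inj₁ _} {inj₂ _} {inj₂ _} = <-trans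
    ≺-trans {inj₂ _} {inj₁ _} {inj₁ _} = λ p q → <⇒≤ (≤-<-trans p q)
    ≺-trans {inj₂ _} {inj₁ _} {inj₂ _} = ≤-<-trans
    ≺-trans {inj₂ _} {inj₂ _} {inj₁ _} = λ p q → <⇒≤ (<-≤-trans p q)
    ≺-trans {inj₂ _} {inj₂ _} {inj₂ _} = <-trans

    ≺-compare : Trichotomous _≡_ _≺_
    ≺-compare (inj₁ u) (inj₁ u') with <-cmp (rank u) (rank u')
    ... | tri< x<y x≢y x≯y = tri< x<y (x≢y ∘ cong rank ∘ inj₁-injective) x≯y
    ... | tri≈ x≮y x≡y x≯y = tri≈ x≮y (cong inj₁ (rank-injective x≡y)) x≯y
    ... | tri> x≮y x≢y x>y = tri> x≮y (x≢y ∘ cong rank ∘ inj₁-injective) x>y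
    ≺-compare (inj₂ v) (inj₂ v') with <-cmp (deg v) (deg v')
    ... | tri< x<y x≢y x≯y = tri< x<y (x≢y ∘ cong deg ∘ inj₂-injective) x≯y
    ... | tri≈ x≮y x≡y x≯y = tri≈ x≮y (cong inj₂ (deg-injective x≡y)) x≯y
    ... | tri> x≮y x≢y x>y = tri> x≮y (x≢y ∘ cong deg ∘ inj₂-injective) x>y
    ≺-compare (inj₁ u) (inj₂ v) with <-cmp (rank u) (deg v)
    ... | tri< x<y _ _ = tri< x<y (λ ()) (<⇒≱ x<y)
    ... | tri≈ _ x≡y _ = tri> (<-irrefl x≡y) (λ ()) (≤-reflexive (sym x≡y))
    ... | tri> _ _ x>y = tri> (<-asym x>y) (λ ()) (<⇒≤ x>y)
    ≺-compare (inj₂ v) (inj₁ u) with <-cmp (rank u) (deg v)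
    ... | tri< x<y _ _ = tri> (<⇒≱ x<y) (λ ()) x<y
    ... | tri≈ _ x≡y _ = tri< (≤-reflexive (sym x≡y)) (λ ()) (<-irrefl x≡y)
    ... | tri> _ _ x>y = tri< (<⇒≤ x>y) (λ ()) (<-asym x>y)

    ≺-isStrictTotalOrder : IsStrictTotalOrder _≡_ _≺_
    ≺-isStrictTotalOrder = record
      { isStrictPartialOrder = record
        { isEquivalence = isEquivalence
        ; irrefl = tri⇒irr ≺-compare
        ; trans = ≺-trans
        ; <-resp-≈ = resp₂ _≺_ }
      ; compare = ≺-compare }

    ≺-linOrd : LinOrd G
    ≺-linOrd = _≺_ , ≺-isStrictTotalOrder

    ≺-normalizedRep : NormalizedRep G ≺-linOrd ≺-linOrd
    ≺-normalizedRep =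
        (λ u v → ×-diagʳ (mk⇔ E⇒rank<deg rank<deg⇒E))
      , (λ u₁ u₂ → ×-diagˡ (mk⇔ rank<⇒⊋ rank-antitone-strict))
      , (λ v₁ v₂ → ×-diagˡ (mk⇔ deg<⇒⊊ deg-mono-strict))
      , (λ u v → ×-diagˡ (mk⇔ deg≤rank⇒⊊N ⊊N⇒deg≤rank))

    ≺⇒normalizedRep : ∀ {X Y} → NormalizedRep G X Y →
      ∀ {a b} → a ≺ b → proj₁ X a b × proj₁ Y a b
    ≺⇒normalizedRep {_<x_ , _} {_<y_ , _} (rep , normU , normV , normUV) {a} {b} = forced a b
      where
      forced : ∀ a b → a ≺ b → a <x b × a <y b
      forced (inj₁ u₁) (inj₁ u₂) = from (normU u₁ u₂) ∘ rank<⇒⊋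
      forced (inj₁ u)  (inj₂ v)  = to (rep u v) ∘ rank<deg⇒E
      forced (inj₂ v)  (inj₁ u)  = from (normUV u v) ∘ deg≤rank⇒⊊N
      forced (inj₂ v₁) (inj₂ v₂) = from (normV v₁ v₂) ∘ deg<⇒⊊

    uniqueNormalizedRep : UniqueNormalizedRep G
    uniqueNormalizedRep = ≺-linOrd , ≺-linOrd , ≺-normalizedRep ,
      λ { X@(_ , isSTOˣ) Y@(_ , isSTOʸ) normalizedRep →
          ≺-maximal isSTOˣ (proj₁ ∘ ≺⇒normalizedRep {X} {Y} normalizedRep)
        , ≺-maximal isSTOʸ (proj₂ ∘ ≺⇒normalizedRep {X} {Y} normalizedRep) }
      where
      ≺-maximal : ∀ {_<_} → IsStrictTotalOrder _≡_ _<_ → _≺_ ⇒ _<_ → ∀ a b → a ≺ b ⇔ a < b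
      ≺-maximal isSTO ≺⇒< _ _ = mk⇔ ≺⇒< (tri∧⊆asym⇒⊇ ≺-compare (IsStrictTotalOrder.asym isSTO) ≺⇒<)

theorem1 : (G : BipGraph) → IsTDORG G → NoTwins G →
    UniqueNormalizedRep G ⇔ IsChainGraph G
theorem1 G _ noTwins = mk⇔
  (⊆ᵁ-total⇒chainGraph G noTwins ∘ uniqueNormalizedRep⇒⊆ᵁ-total G)
  (ChainGraph.uniqueNormalizedRep G noTwins ∘ chainGraph⇒⊆ᵁ-total G)
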